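{- Let $M(2)$ be the graph with two vertices $1,2$ joined by an edge. Let $b\ge0$ be an integer, $c=b+2$, and let $\mathcal{F}$ be a finite family of permutations of the vertices of $M(2)$ with $b$ blank spaces. Then \[ \alpha(H_{\mathcal{F},M(2)}) \geq \frac{2^{c-2}}{2^c-2}\,|\mathcal{F}|. \]
   Context: For a finite graph $G$ with $n$ vertices and an integer $b\ge 0$, a permutation of the vertices of $G$ with $b$ blank spaces is a sequence of length $n+b$ in which every vertex of $G$ appears exactly once and the remaining $b$ entries are a blank symbol $*$. Two such sequences $\pi,\sigma$ are $G$-different if there is a position $i$ such that $\pi(i),\sigma(i)$ are both vertices and $\{\pi(i),\sigma(i)\}$ is an edge of $G$. For a family $\mathcal{F}$ of such sequences (all of the same length), $H_{\mathcal{F},G}$ is the graph whose vertices are the members of $\mathcal{F}$ and in which two members are adjacent iff they are $G$-different. $\alpha$ denotes the independence number. -}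

module Defs where

open import Data.Nat using (ℕ; zero; suc)
open import Data.Fin using (Fin)
open import Data.Maybe using (Maybe; just; nothing)
open import Data.Vec using (Vec; []; _∷_; lookup)
open import Data.Product using (Σ; ∃; _×_)
open import Data.List using (List)
open import Data.List.Membership.Propositional using (_∈_)
open import Data.List.Relation.Unary.All using (All)
open import Data.List.Relation.Unary.AllPairs using (AllPairs)
open import Relation.Nullary using (¬_)
open import Relation.Binary.PropositionalEquality using (_≡_; _≢_)

-- A graph on vertex set Fin n, given by its (symmetric, irreflexive) edge relation.
-- A sequence of length m over the vertices with blanks: position i holds
-- 'just v' (vertex v) or 'nothing' (the blank symbol *).
Seq : ℕ → ℕ → Set
Seq n m = Vec (Maybe (Fin n)) m

occ : ∀ {n m} → Fin n → Seq n m → ℕ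
occ v [] = 0
occ v (nothing ∷ s) = occ v s
occ v (just u ∷ s) with Data.Fin._≟_ u v
... | Relation.Nullary.yes _ = suc (occ v s)
... | Relation.Nullary.no _ = occ v s

-- a permutation of the n vertices with b blank spaces: length n + b,
-- every vertex exactly once (hence exactly b blanks)
IsPermBlank : ∀ n b → Seq n (n Data.Nat.+ b) → Set
IsPermBlank n b s = ∀ v → occ v s ≡ 1

GDifferent : ∀ {n m} → (Fin n → Fin n → Set) → Seq n m → Seq n m → Set
GDifferent {n} {m} E π σ =
  Σ (Fin m) λ i → Σ (Fin n) λ u → Σ (Fin n) λ v →
    (lookup π i ≡ just u) × (lookup σ i ≡ just v) × E u v

M2 : Fin 2 → Fin 2 → Set
M2 u v = u ≢ v

IsIndependent : ∀ {n m} → (Fin n → Fin n → Set) →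
                List (Seq n m) → List (Seq n m) → Set
IsIndependent E F I =
  All (_∈ F) I × AllPairs _≢_ I × AllPairs (λ x y → ¬ GDifferent E x y) I

module Submission where

-- Proof idea: an averaging argument over "templates".
--
-- A template of length c is a word S ∈ {v₁,v₂}^c.  A sequence π with blanks
-- fits S if every vertex of π sits at a position where S shows that same
-- vertex.  Two sequences fitting a common template agree at every position
-- where both carry a vertex, so they are never G-different for an irreflexive
-- edge relation E: the members of F fitting S form an independent set.
--
-- A sequence with k blanks fits exactly 2^k templates (each blank is free, each
-- vertex forces its position).  A permutation of {v₁,v₂} with b blanks uses
-- both vertices, so none of its 2^b templates is constant; all of them lie
-- among the 2^c − 2 non-constant templates (c = b + 2).  Double counting the
-- pairs (π, S) with π ∈ F fitting a non-constant S gives 2^b·|F| pairs, so some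
-- non-constant S is fitted by at least 2^b·|F| / (2^c − 2) members of F.

open import Defs
open import Data.Nat using (ℕ; _+_; _*_; _∸_; _^_; _≤_)
open import Data.List using (List; length)
open import Data.List.Relation.Unary.All using (All)
open import Data.List.Relation.Unary.Unique.Propositional using (Unique)
open import Data.Product using (Σ; _×_)

open import Function using (_∘_; Equivalence)
open import Data.Nat using (zero; suc; _<_; z≤n; s≤s)
open import Data.Nat.Properties
  using ( +-assoc; +-comm; +-suc; +-identityʳ; +-mono-≤; +-cancelʳ-≡; *-comm
        ; *-identityˡ; *-distribʳ-+; m+n∸m≡n; 0≢1+n; module ≤-Reasoning)
open import Data.Nat.ListAction using (sum)
open import Data.Nat.ListAction.Properties using (sum-++)
open import Data.Nat.Tactic.RingSolver using (solve-∀)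
open import Data.Bool using (Bool; true; false; T; _∧_)
open import Data.Bool.Properties using (T-∧)
open import Data.Fin using (Fin) renaming (zero to fzero; suc to fsuc)
open import Data.Fin.Properties using (_≟_)
open import Data.Maybe using (Maybe; just; nothing)
open import Data.Vec using (Vec; []; _∷_; lookup; replicate)
open import Data.List using ([]; _∷_; _++_; map; filterᵇ)
open import Data.List.Properties using (map-++; map-∘; length-++; length-map)
open import Data.List.Relation.Unary.All using ([]; _∷_)
import Data.List.Relation.Unary.All as All
open import Data.List.Relation.Unary.All.Properties using (all-filter)
open import Data.List.Relation.Unary.AllPairs using (AllPairs; []; _∷_)
import Data.List.Relation.Unary.AllPairs.Properties as AllPairs
open import Data.List.Relation.Binary.Subset.Propositional.Properties using (filter-⊆)
open import Data.List.Extrema.Nat using (argmax; f[⊥]≤f[argmax]; f[xs]≤f[argmax])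
open import Data.Product using (_,_; proj₁; proj₂)
open import Data.Empty using (⊥-elim)
open import Relation.Nullary using (¬_; yes; no)
open import Relation.Nullary.Decidable using (⌊_⌋; toWitness; T?)
open import Relation.Binary.PropositionalEquality

𝟙 : Bool → ℕ
𝟙 true  = 1
𝟙 false = 0

count : ∀ {A : Set} → (A → Bool) → List A → ℕ
count p xs = sum (map (𝟙 ∘ p) xs)

sum-zero : ∀ {A : Set} (xs : List A) → sum (map (λ _ → 0) xs) ≡ 0
sum-zero []       = refl
sum-zero (x ∷ xs) = sum-zero xs

sum-map-+ : ∀ {A : Set} (f g : A → ℕ) (xs : List A) →
  sum (map (λ x → f x + g x) xs) ≡ sum (map f xs) + sum (map g xs)
sum-map-+ f g []       = refl
sum-map-+ f g (x ∷ xs) = begin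
  f x + g x + sum (map (λ x → f x + g x) xs)   ≡⟨ cong (f x + g x +_) (sum-map-+ f g xs) ⟩
  f x + g x + (sum (map f xs) + sum (map g xs)) ≡⟨ +-interchange (f x) (g x) _ _ ⟩
  f x + sum (map f xs) + (g x + sum (map g xs)) ∎
  where
  open ≡-Reasoning
  +-interchange : ∀ a b c d → a + b + (c + d) ≡ a + c + (b + d)
  +-interchange = solve-∀

sum-swap : ∀ {A B : Set} (f : A → B → ℕ) (xs : List A) (ys : List B) →
  sum (map (λ x → sum (map (f x) ys)) xs) ≡ sum (map (λ y → sum (map (λ x → f x y) xs)) ys)
sum-swap f []       ys = sym (sum-zero ys)
sum-swap f (x ∷ xs) ys = begin
  sum (map (f x) ys) + sum (map (λ x → sum (map (f x) ys)) xs)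
    ≡⟨ cong (sum (map (f x) ys) +_) (sum-swap f xs ys) ⟩
  sum (map (f x) ys) + sum (map (λ y → sum (map (λ x → f x y) xs)) ys)
    ≡⟨ sym (sum-map-+ (f x) (λ y → sum (map (λ x → f x y) xs)) ys) ⟩
  sum (map (λ y → f x y + sum (map (λ x → f x y) xs)) ys) ∎
  where open ≡-Reasoning

sum-const : ∀ {A : Set} (g : A → ℕ) {k : ℕ} (xs : List A) →
  All (λ x → g x ≡ k) xs → sum (map g xs) ≡ length xs * k
sum-const g []       []         = refl
sum-const g (x ∷ xs) (gx≡k ∷ h) = cong₂ _+_ gx≡k (sum-const g xs h)

sum-bound : ∀ {A : Set} (g : A → ℕ) {k : ℕ} (xs : List A) →
  All (λ x → g x ≤ k) xs → sum (map g xs) ≤ length xs * k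
sum-bound g []       []         = z≤n
sum-bound g (x ∷ xs) (gx≤k ∷ h) = +-mono-≤ gx≤k (sum-bound g xs h)

pigeonhole : ∀ {A : Set} (g : A → ℕ) (xs : List A) → 0 < length xs →
  Σ A λ a → sum (map g xs) ≤ length xs * g a
pigeonhole g (x ∷ xs) _ =
  argmax g x xs , sum-bound g (x ∷ xs) (f[⊥]≤f[argmax] {f = g} x xs ∷ f[xs]≤f[argmax] {f = g} x xs)

count-++ : ∀ {A : Set} (p : A → Bool) (xs ys : List A) →
  count p (xs ++ ys) ≡ count p xs + count p ys
count-++ p xs ys = trans (cong sum (map-++ (𝟙 ∘ p) xs ys)) (sum-++ (map (𝟙 ∘ p) xs) _)

count-map : ∀ {A B : Set} (p : B → Bool) (f : A → B) (xs : List A) →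
  count p (map f xs) ≡ count (p ∘ f) xs
count-map p f xs = cong sum (sym (map-∘ xs))

count-∧ : ∀ {A : Set} (b : Bool) (q : A → Bool) (xs : List A) →
  count (λ x → b ∧ q x) xs ≡ 𝟙 b * count q xs
count-∧ true  q xs = sym (+-identityʳ (count q xs))
count-∧ false q xs = sum-zero xs

count-true : ∀ {A : Set} (xs : List A) → count (λ _ → true) xs ≡ length xs
count-true []       = refl
count-true (x ∷ xs) = cong suc (count-true xs)

length-filterᵇ : ∀ {A : Set} (p : A → Bool) (xs : List A) →
  length (filterᵇ p xs) ≡ count p xs
length-filterᵇ p []       = refl
length-filterᵇ p (x ∷ xs) with p x
... | true  = cong suc (length-filterᵇ p xs)
... | false = length-filterᵇ p xs

allPairs-from-All : ∀ {A : Set} {P : A → Set} {R : A → A → Set} →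
  (∀ {x y} → P x → P y → R x y) → ∀ {xs} → All P xs → AllPairs R xs
allPairs-from-All r []          = []
allPairs-from-All r (px ∷ pxs) = All.map (r px) pxs ∷ allPairs-from-All r pxs

agrees : ∀ {n} → Fin n → Maybe (Fin n) → Bool
agrees t nothing  = true
agrees t (just u) = ⌊ u ≟ t ⌋

agrees-vertex : ∀ {n} {t u : Fin n} → T (agrees t (just u)) → u ≡ t
agrees-vertex {t = t} {u} = toWitness {a? = u ≟ t}

fits : ∀ {n c} → Vec (Fin n) c → Seq n c → Bool
fits []      []      = true
fits (t ∷ S) (x ∷ π) = agrees t x ∧ fits S π

fits-uncons : ∀ {n c} (t : Fin n) (S : Vec (Fin n) c) (x : Maybe (Fin n)) (π : Seq n c) →
  T (fits (t ∷ S) (x ∷ π)) → T (agrees t x) × T (fits S π)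
fits-uncons t S x π = Equivalence.to (T-∧ {agrees t x} {fits S π})

fits-lookup : ∀ {n c} (S : Vec (Fin n) c) (π : Seq n c) (i : Fin c) {u : Fin n} →
  T (fits S π) → lookup π i ≡ just u → u ≡ lookup S i
fits-lookup (t ∷ S) (x ∷ π) fzero    fit refl = agrees-vertex (proj₁ (fits-uncons t S x π fit))
fits-lookup (t ∷ S) (x ∷ π) (fsuc i) fit π[i] = fits-lookup S π i (proj₂ (fits-uncons t S x π fit)) π[i]

-- Sequences fitting a common template are not E-different when E is irreflexive:
-- at any position where both carry a vertex, it is the same vertex.
fit-together : ∀ {n c} {E : Fin n → Fin n → Set} → (∀ {u} → ¬ E u u) →
  (S : Vec (Fin n) c) {π σ : Seq n c} → T (fits S π) → T (fits S σ) → ¬ GDifferent E π σ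
fit-together {E = E} irrefl S {π} {σ} fitπ fitσ (i , u , v , π[i] , σ[i] , Euv) =
  irrefl (subst (E u) (sym u≡v) Euv)
  where
  u≡v : u ≡ v
  u≡v = trans (fits-lookup S π i fitπ π[i]) (sym (fits-lookup S σ i fitσ σ[i]))

fitting : ∀ {n c} → Vec (Fin n) c → List (Seq n c) → List (Seq n c)
fitting S F = filterᵇ (fits S) F

fitting-independent : ∀ {n c} (E : Fin n → Fin n → Set) → (∀ {u} → ¬ E u u) →
  (S : Vec (Fin n) c) (F : List (Seq n c)) → Unique F → IsIndependent E F (fitting S F)
fitting-independent E irrefl S F uniqueF =
    All.tabulate (filter-⊆ (T? ∘ fits S) F)
  , AllPairs.filter⁺ (T? ∘ fits S) uniqueF
  , allPairs-from-All (fit-together irrefl S) (all-filter (T? ∘ fits S) F)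

fits-constant : ∀ {n c} {t u : Fin n} (π : Seq n c) → u ≢ t →
  T (fits (replicate c t) π) → occ u π ≡ 0
fits-constant []            u≢t fit = refl
fits-constant (nothing ∷ π) u≢t fit = fits-constant π u≢t fit
fits-constant {c = suc c} {t} {u} (just w ∷ π) u≢t fit with w ≟ u
... | yes w≡u = ⊥-elim (u≢t (trans (sym w≡u) (agrees-vertex (proj₁ (fits-uncons t (replicate c t) (just w) π fit)))))
... | no  _   = fits-constant π u≢t (proj₂ (fits-uncons t (replicate c t) (just w) π fit))

pattern v₁ = fzero
pattern v₂ = fsuc fzero

templates : ∀ c → List (Vec (Fin 2) c)
templates zero    = [] ∷ []
templates (suc c) = map (v₁ ∷_) (templates c) ++ map (v₂ ∷_) (templates c)

nonConstant : ∀ c → List (Vec (Fin 2) (suc c))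
nonConstant zero    = []
nonConstant (suc c) =
  (v₁ ∷ replicate (suc c) v₂) ∷ (v₂ ∷ replicate (suc c) v₁) ∷
  map (v₁ ∷_) (nonConstant c) ++ map (v₂ ∷_) (nonConstant c)

count-first-letter : ∀ {c} (p : Vec (Fin 2) (suc c) → Bool) (L : List (Vec (Fin 2) c)) →
  count p (map (v₁ ∷_) L ++ map (v₂ ∷_) L) ≡ count (p ∘ (v₁ ∷_)) L + count (p ∘ (v₂ ∷_)) L
count-first-letter p L =
  trans (count-++ p (map (v₁ ∷_) L) _) (cong₂ _+_ (count-map p (v₁ ∷_) L) (count-map p (v₂ ∷_) L))

count-templates : ∀ c (p : Vec (Fin 2) (suc c) → Bool) →
  count p (templates (suc c)) ≡
  𝟙 (p (replicate (suc c) v₁)) + 𝟙 (p (replicate (suc c) v₂)) + count p (nonConstant c)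
count-templates zero    p = sym (+-assoc (𝟙 (p (v₁ ∷ []))) (𝟙 (p (v₂ ∷ []))) 0)
count-templates (suc c) p = begin
  count p (templates (suc (suc c)))
    ≡⟨ count-first-letter p (templates (suc c)) ⟩
  count (p ∘ (v₁ ∷_)) (templates (suc c)) + count (p ∘ (v₂ ∷_)) (templates (suc c))
    ≡⟨ cong₂ _+_ (count-templates c (p ∘ (v₁ ∷_))) (count-templates c (p ∘ (v₂ ∷_))) ⟩
  (𝟙 (p all₁) + 𝟙 (p v₁all₂) + m₁) + (𝟙 (p v₂all₁) + 𝟙 (p all₂) + m₂)
    ≡⟨ regroup (𝟙 (p all₁)) (𝟙 (p v₁all₂)) m₁ (𝟙 (p v₂all₁)) (𝟙 (p all₂)) m₂ ⟩
  𝟙 (p all₁) + 𝟙 (p all₂) + (𝟙 (p v₁all₂) + (𝟙 (p v₂all₁) + (m₁ + m₂)))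
    ≡⟨ cong (λ m → 𝟙 (p all₁) + 𝟙 (p all₂) + (𝟙 (p v₁all₂) + (𝟙 (p v₂all₁) + m)))
            (sym (count-first-letter p (nonConstant c))) ⟩
  𝟙 (p all₁) + 𝟙 (p all₂) + count p (nonConstant (suc c)) ∎
  where
  open ≡-Reasoning
  all₁ all₂ v₁all₂ v₂all₁ : Vec (Fin 2) (suc (suc c))
  all₁   = replicate (suc (suc c)) v₁
  all₂   = replicate (suc (suc c)) v₂
  v₁all₂ = v₁ ∷ replicate (suc c) v₂
  v₂all₁ = v₂ ∷ replicate (suc c) v₁
  m₁ m₂ : ℕ
  m₁ = count (p ∘ (v₁ ∷_)) (nonConstant c)
  m₂ = count (p ∘ (v₂ ∷_)) (nonConstant c)
  regroup : ∀ a b m a′ b′ m′ → a + b + m + (a′ + b′ + m′) ≡ a + b′ + (b + (a′ + (m + m′)))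
  regroup = solve-∀

length-templates : ∀ c → length (templates c) ≡ 2 ^ c
length-templates zero    = refl
length-templates (suc c) = begin
  length (map (v₁ ∷_) (templates c) ++ map (v₂ ∷_) (templates c))
    ≡⟨ length-++ (map (v₁ ∷_) (templates c)) ⟩
  length (map (v₁ ∷_) (templates c)) + length (map (v₂ ∷_) (templates c))
    ≡⟨ cong₂ _+_ (length-map (v₁ ∷_) (templates c)) (length-map (v₂ ∷_) (templates c)) ⟩
  length (templates c) + length (templates c)
    ≡⟨ cong (λ k → k + k) (length-templates c) ⟩
  2 ^ c + 2 ^ c
    ≡⟨ cong (2 ^ c +_) (sym (+-identityʳ (2 ^ c))) ⟩
  2 ^ suc c ∎
  where open ≡-Reasoning

length-nonConstant : ∀ c → length (nonConstant c) ≡ 2 ^ suc c ∸ 2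
length-nonConstant c = begin
  length (nonConstant c)                  ≡⟨ sym (m+n∸m≡n 2 (length (nonConstant c))) ⟩
  2 + length (nonConstant c) ∸ 2          ≡⟨ cong (λ k → 2 + k ∸ 2) (sym (count-true (nonConstant c))) ⟩
  2 + count (λ _ → true) (nonConstant c) ∸ 2 ≡⟨ cong (_∸ 2) (sym (count-templates c (λ _ → true))) ⟩
  count (λ _ → true) (templates (suc c)) ∸ 2 ≡⟨ cong (_∸ 2) (count-true (templates (suc c))) ⟩
  length (templates (suc c)) ∸ 2          ≡⟨ cong (_∸ 2) (length-templates (suc c)) ⟩
  2 ^ suc c ∸ 2 ∎
  where open ≡-Reasoning

blanks : ∀ {n m} → Seq n m → ℕ
blanks []             = 0
blanks (nothing ∷ π)  = suc (blanks π)
blanks (just _  ∷ π)  = blanks π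

-- A blank entry agrees with both letters, a vertex with exactly one.
agreeing-letters : ∀ {m} (x : Maybe (Fin 2)) (π : Seq 2 m) →
  (𝟙 (agrees v₁ x) + 𝟙 (agrees v₂ x)) * 2 ^ blanks π ≡ 2 ^ blanks (x ∷ π)
agreeing-letters nothing   π = refl
agreeing-letters (just v₁) π = *-identityˡ (2 ^ blanks π)
agreeing-letters (just v₂) π = *-identityˡ (2 ^ blanks π)

fits-count : ∀ {c} (π : Seq 2 c) → count (λ S → fits S π) (templates c) ≡ 2 ^ blanks π
fits-count []      = refl
fits-count {suc c} (x ∷ π) = begin
  count (λ S → fits S (x ∷ π)) (templates (suc c))
    ≡⟨ count-first-letter (λ S → fits S (x ∷ π)) (templates c) ⟩
  count (λ S → agrees v₁ x ∧ fits S π) (templates c) + count (λ S → agrees v₂ x ∧ fits S π) (templates c)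
    ≡⟨ cong₂ _+_ (count-∧ (agrees v₁ x) (λ S → fits S π) (templates c))
                 (count-∧ (agrees v₂ x) (λ S → fits S π) (templates c)) ⟩
  𝟙 (agrees v₁ x) * N + 𝟙 (agrees v₂ x) * N
    ≡⟨ sym (*-distribʳ-+ N (𝟙 (agrees v₁ x)) (𝟙 (agrees v₂ x))) ⟩
  (𝟙 (agrees v₁ x) + 𝟙 (agrees v₂ x)) * N
    ≡⟨ cong ((𝟙 (agrees v₁ x) + 𝟙 (agrees v₂ x)) *_) (fits-count π) ⟩
  (𝟙 (agrees v₁ x) + 𝟙 (agrees v₂ x)) * 2 ^ blanks π
    ≡⟨ agreeing-letters x π ⟩
  2 ^ blanks (x ∷ π) ∎
  where
  open ≡-Reasoning
  N : ℕ
  N = count (λ S → fits S π) (templates c)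

blanks-occ : ∀ {m} (π : Seq 2 m) → blanks π + occ v₁ π + occ v₂ π ≡ m
blanks-occ []             = refl
blanks-occ (nothing ∷ π)  = cong suc (blanks-occ π)
blanks-occ (just v₁ ∷ π)  =
  trans (+-suc-middle (blanks π) (occ v₁ π) (occ v₂ π)) (cong suc (blanks-occ π))
  where
  +-suc-middle : ∀ a b c → a + suc b + c ≡ suc (a + b + c)
  +-suc-middle = solve-∀
blanks-occ (just v₂ ∷ π)  =
  trans (+-suc (blanks π + occ v₁ π) (occ v₂ π)) (cong suc (blanks-occ π))

perm-blanks : ∀ b (π : Seq 2 (2 + b)) → IsPermBlank 2 b π → blanks π ≡ b
perm-blanks b π perm = +-cancelʳ-≡ 2 (blanks π) b (begin
  blanks π + 2                     ≡⟨ sym (+-assoc (blanks π) 1 1) ⟩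
  blanks π + 1 + 1                 ≡⟨ cong₂ (λ k l → blanks π + k + l) (sym (perm v₁)) (sym (perm v₂)) ⟩
  blanks π + occ v₁ π + occ v₂ π   ≡⟨ blanks-occ π ⟩
  2 + b                            ≡⟨ +-comm 2 b ⟩
  b + 2 ∎)
  where open ≡-Reasoning

other : Fin 2 → Fin 2
other v₁ = v₂
other v₂ = v₁

other-≢ : ∀ t → other t ≢ t
other-≢ v₁ ()
other-≢ v₂ ()

𝟙-false : ∀ {b} → ¬ T b → 𝟙 b ≡ 0
𝟙-false {false} _  = refl
𝟙-false {true}  ¬T = ⊥-elim (¬T _)

-- A permutation of {v₁,v₂} contains both vertices, so fits no constant template.
perm-not-constant : ∀ b (π : Seq 2 (2 + b)) → IsPermBlank 2 b π →
  (t : Fin 2) → 𝟙 (fits (replicate (2 + b) t) π) ≡ 0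
perm-not-constant b π perm t = 𝟙-false λ fit →
  0≢1+n (trans (sym (fits-constant π (other-≢ t) fit)) (perm (other t)))

perm-fits-count : ∀ b (π : Seq 2 (2 + b)) → IsPermBlank 2 b π →
  count (λ S → fits S π) (nonConstant (suc b)) ≡ 2 ^ b
perm-fits-count b π perm = begin
  count (λ S → fits S π) (nonConstant (suc b))
    ≡⟨ cong₂ (λ k l → k + l + count (λ S → fits S π) (nonConstant (suc b)))
             (sym (perm-not-constant b π perm v₁)) (sym (perm-not-constant b π perm v₂)) ⟩
  𝟙 (fits (replicate (2 + b) v₁) π) + 𝟙 (fits (replicate (2 + b) v₂) π)
    + count (λ S → fits S π) (nonConstant (suc b))
    ≡⟨ sym (count-templates (suc b) (λ S → fits S π)) ⟩
  count (λ S → fits S π) (templates (2 + b))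
    ≡⟨ fits-count π ⟩
  2 ^ blanks π
    ≡⟨ cong (2 ^_) (perm-blanks b π perm) ⟩
  2 ^ b ∎
  where open ≡-Reasoning

lemma5 : (b : ℕ) (F : List (Seq 2 (2 + b))) →
    Unique F → All (IsPermBlank 2 b) F →
    Σ (List (Seq 2 (2 + b))) λ I →
    IsIndependent M2 F I ×
    (2 ^ b * length F ≤ (2 ^ (b + 2) ∸ 2) * length I)
lemma5 b F uniqueF permsF =
  fitting S⋆ F , fitting-independent M2 (λ u≢u → u≢u refl) S⋆ F uniqueF , bound
  where
  L : List (Vec (Fin 2) (2 + b))
  L = nonConstant (suc b)
  best : Σ (Vec (Fin 2) (2 + b)) λ S′ → sum (map (λ S → count (fits S) F) L) ≤ length L * count (fits S′) F
  best = pigeonhole (λ S → count (fits S) F) L (s≤s z≤n)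
  S⋆ : Vec (Fin 2) (2 + b)
  S⋆ = proj₁ best
  open ≤-Reasoning
  bound : 2 ^ b * length F ≤ (2 ^ (b + 2) ∸ 2) * length (fitting S⋆ F)
  bound = begin
    2 ^ b * length F
      ≡⟨ *-comm (2 ^ b) (length F) ⟩
    length F * 2 ^ b
      ≡⟨ sym (sum-const _ F (All.map (λ {π} → perm-fits-count b π) permsF)) ⟩
    sum (map (λ π → count (λ S → fits S π) L) F)
      ≡⟨ sym (sum-swap (λ S π → 𝟙 (fits S π)) L F) ⟩
    sum (map (λ S → count (fits S) F) L)
      ≤⟨ proj₂ best ⟩
    length L * count (fits S⋆) F
      ≡⟨ cong₂ _*_ (trans (length-nonConstant (suc b)) (cong (λ k → 2 ^ k ∸ 2) (+-comm 2 b)))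
                   (sym (length-filterᵇ (fits S⋆) F)) ⟩
    (2 ^ (b + 2) ∸ 2) * length (fitting S⋆ F) ∎
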